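{- Let $n\ge 1$ be an integer, let $p$ be a prime with $4n < p < 8n$, and let $(a,b,c,d,e)$ be chosen uniformly at random from $\{(a,b,c,d,e) \in \mathbb{F}_p^5 : ad-bc \neq 0\}$. Let $$A = \{(x,y) \in \{0,\dots,n-1\}^2 : (ax+by)^2 \equiv cx+dy+e \pmod p\}.$$ Then with probability $1$, $A$ contains no parallelogram, i.e. there are no four distinct points of $A$ of the form $P, P+H, P+K, P+H+K$ with $P,H,K \in \mathbb{Z}^2$.
   Context: $\mathbb{F}_p$ denotes the field with $p$ elements. -}

module Defs where

open import Data.Nat as ℕ using (ℕ)
open import Data.Fin using (Fin; toℕ)
open import Data.Integer using (ℤ; +_; _+_; _-_; _*_; _≤_; _<_)
open import Data.Integer.Divisibility using (_∣_)
open import Data.Product using (_×_; _,_; Σ-syntax)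
open import Relation.Nullary using (¬_)
open import Relation.Binary.PropositionalEquality using (_≢_)

-- An element of 𝔽_p is represented by its canonical residue in Fin p,
-- lifted to ℤ for computations; equalities in 𝔽_p are congruences mod p.
ι : {p : ℕ} → Fin p → ℤ
ι x = + (toℕ x)

_≡_[mod_] : ℤ → ℤ → ℕ → Set
u ≡ v [mod p ] = (+ p) ∣ (u - v)

Nondegenerate : (p : ℕ) → (a b c d : Fin p) → Set
Nondegenerate p a b c d = ¬ ((ι a * ι d - ι b * ι c) ≡ + 0 [mod p ])

Point : Set
Point = ℤ × ℤ

_⊕_ : Point → Point → Point
(x , y) ⊕ (x' , y') = (x + x' , y + y')

InA : (n p : ℕ) → (a b c d e : Fin p) → Point → Set
InA n p a b c d e (x , y) =
  (+ 0 ≤ x) × (x < + n) × (+ 0 ≤ y) × (y < + n) ×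
  (((ι a * x + ι b * y) * (ι a * x + ι b * y)) ≡ (ι c * x + ι d * y + ι e) [mod p ])

HasParallelogram : (Point → Set) → Set
HasParallelogram A = Σ[ P ∈ Point ] Σ[ H ∈ Point ] Σ[ K ∈ Point ]
  ( A P × A (P ⊕ H) × A (P ⊕ K) × A ((P ⊕ H) ⊕ K)
  × P ≢ P ⊕ H × P ≢ P ⊕ K × P ≢ (P ⊕ H) ⊕ K
  × P ⊕ H ≢ P ⊕ K × P ⊕ H ≢ (P ⊕ H) ⊕ K × P ⊕ K ≢ (P ⊕ H) ⊕ K )

{-# OPTIONS --safe #-}
-- The substitution (x, y) ↦ (ax + by, cx + dy) is invertible mod p, and A lies on the
-- parabola f = 0 where f(P) = (ax + by)² − (cx + dy + e). Write L(H) = ah₁ + bh₂. The second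
-- difference f(P+H+K) − f(P+H) − f(P+K) + f(P) equals 2·L(H)·L(K), so on a parallelogram in A
-- the odd prime p divides L(H), say. The first difference f(P+H) − f(P) = L(H)(2L(P) + L(H))
-- − (ch₁ + dh₂) then gives p ∣ ch₁ + dh₂ too, hence H ≡ 0 mod p by invertibility, and
-- H = 0 because P and P + H both lie in a box of side n ≤ p.
module Submission where

open import Defs
open import Data.Product using (_×_; _,_; proj₁; proj₂)
open import Function using (_∘_)
open import Relation.Binary.PropositionalEquality using (_≡_; refl; sym; trans; cong; cong₂; subst)

module _ where

  open import Data.Nat as ℕ using (ℕ; zero; suc)
  import Data.Nat.Properties as ℕ
  open import Data.Nat.Divisibility as ℕ using (>⇒∤)
  open import Data.Nat.Primality using (Prime; euclidsLemma)
  open import Data.Fin using (Fin)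
  open import Data.Integer using (ℤ; +_; -_; _+_; _-_; _*_; _≤_; _<_; +≤+; +<+)
  import Data.Integer as ℤ
  open import Data.Integer.Properties
    using (abs-*; neg-involutive; +-identityʳ; m-n≡m⊖n; ∣m⊝n∣≤m⊔n; ∣i∣≡0⇒i≡0; i-j≡0⇒i≡j)
  open import Data.Integer.Divisibility.Signed
    using (_∣_; ∣ᵤ⇒∣; ∣⇒∣ᵤ; ∣m∣n⇒∣m+n; ∣m∣n⇒∣m-n; ∣m+n∣m⇒∣n; ∣m⇒∣-m; ∣n⇒∣m*n; ∣m⇒∣m*n)
  open import Data.Integer.Tactic.RingSolver using (solve-∀)
  open import Algebra.Morphism.Definitions Point ℤ _≡_ using (Homomorphic₂)
  open import Data.Sum using (_⊎_; map; fromInj₂)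
  open import Data.Empty using (⊥-elim)
  open import Relation.Nullary using (¬_)

  euclidsLemmaℤ : ∀ {p} → Prime p → ∀ i j → + p ∣ i * j → + p ∣ i ⊎ + p ∣ j
  euclidsLemmaℤ {p} p-prime i j p∣ij =
    map ∣ᵤ⇒∣ ∣ᵤ⇒∣ (euclidsLemma ℤ.∣ i ∣ ℤ.∣ j ∣ p-prime (subst (p ℕ.∣_) (abs-* i j) (∣⇒∣ᵤ p∣ij)))

  prime∤k∧∣k*i⇒∣i : ∀ {p} → Prime p → ∀ {k} i → ¬ (+ p ∣ k) → + p ∣ k * i → + p ∣ i
  prime∤k∧∣k*i⇒∣i p-prime {k} i p∤k p∣ki = fromInj₂ (⊥-elim ∘ p∤k) (euclidsLemmaℤ p-prime k i p∣ki)

  congruent-in-window⇒≡ : ∀ {n p x y} → n ℕ.≤ p →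
    + 0 ≤ x → x < + n → + 0 ≤ y → y < + n → x ≡ y [mod p ] → x ≡ y
  congruent-in-window⇒≡ {n} {p} {+ u} {+ v} n≤p (+≤+ _) (+<+ u<n) (+≤+ _) (+<+ v<n) p∣u-v =
    i-j≡0⇒i≡j (+ u) (+ v) (∣i∣≡0⇒i≡0 (small-multiple⇒0 ∣u-v∣<p p∣u-v))
    where
    open ℕ.≤-Reasoning
    ∣u-v∣<p : ℤ.∣ + u - + v ∣ ℕ.< p
    ∣u-v∣<p = begin-strict
      ℤ.∣ + u - + v ∣ ≡⟨ cong ℤ.∣_∣ (m-n≡m⊖n u v) ⟩
      ℤ.∣ u ℤ.⊖ v ∣   ≤⟨ ∣m⊝n∣≤m⊔n u v ⟩
      u ℕ.⊔ v         <⟨ ℕ.⊔-pres-<m u<n v<n ⟩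
      n               ≤⟨ n≤p ⟩
      p               ∎
    small-multiple⇒0 : ∀ {m} → m ℕ.< p → p ℕ.∣ m → m ≡ 0
    small-multiple⇒0 {zero}  _   _   = refl
    small-multiple⇒0 {suc m} m<p p∣m = ⊥-elim (>⇒∤ m<p p∣m)

  form : ℤ → ℤ → Point → ℤ
  form a b (x , y) = a * x + b * y

  form-additive : ∀ a b → Homomorphic₂ (form a b) _⊕_ _+_
  form-additive a b (x , y) (x′ , y′) = distrib a b x y x′ y′
    where
    distrib : ∀ a b x y x′ y′ → a * (x + x′) + b * (y + y′) ≡ (a * x + b * y) + (a * x′ + b * y′)
    distrib = solve-∀

  parabola : ℤ → ℤ → ℤ → ℤ
  parabola e u v = u * u - (v + e)

  parabola-first-difference : ∀ e u h v s →
    parabola e (u + h) (v + s) - parabola e u v ≡ h * (+ 2 * u + h) - s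
  parabola-first-difference = identity
    where
    identity : ∀ e u h v s →
      (u + h) * (u + h) - (v + s + e) - (u * u - (v + e)) ≡ h * (+ 2 * u + h) - s
    identity = solve-∀

  parabola-second-difference : ∀ e u h k v s t →
    parabola e (u + h + k) (v + s + t) - parabola e (u + h) (v + s)
      - parabola e (u + k) (v + t) + parabola e u v ≡ + 2 * (h * k)
  parabola-second-difference = identity
    where
    identity : ∀ e u h k v s t →
      (u + h + k) * (u + h + k) - (v + s + t + e) - ((u + h) * (u + h) - (v + s + e))
        - ((u + k) * (u + k) - (v + t + e)) + (u * u - (v + e)) ≡ + 2 * (h * k)
    identity = solve-∀

  cramer₁ : ∀ a b c d h₁ h₂ → d * (a * h₁ + b * h₂) - b * (c * h₁ + d * h₂) ≡ (a * d - b * c) * h₁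
  cramer₁ = solve-∀

  cramer₂ : ∀ a b c d h₁ h₂ → a * (c * h₁ + d * h₂) - c * (a * h₁ + b * h₂) ≡ (a * d - b * c) * h₂
  cramer₂ = solve-∀

  module Conic (a b c d e : ℤ) where

    L M : Point → ℤ
    L = form a b
    M = form c d

    conic : Point → ℤ
    conic P = parabola e (L P) (M P)

    conic-⊕ : ∀ P H → conic (P ⊕ H) ≡ parabola e (L P + L H) (M P + M H)
    conic-⊕ P H = cong₂ (parabola e) (form-additive a b P H) (form-additive c d P H)

    conic-⊕⊕ : ∀ P H K → conic ((P ⊕ H) ⊕ K) ≡ parabola e (L P + L H + L K) (M P + M H + M K)
    conic-⊕⊕ P H K = trans (conic-⊕ (P ⊕ H) K)
      (cong₂ (λ u v → parabola e (u + L K) (v + M K)) (form-additive a b P H) (form-additive c d P H))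

    conic-first-difference : ∀ P H → conic (P ⊕ H) - conic P ≡ L H * (+ 2 * L P + L H) - M H
    conic-first-difference P H = trans (cong (_- conic P) (conic-⊕ P H))
      (parabola-first-difference e (L P) (L H) (M P) (M H))

    conic-second-difference : ∀ P H K →
      conic ((P ⊕ H) ⊕ K) - conic (P ⊕ H) - conic (P ⊕ K) + conic P ≡ + 2 * (L H * L K)
    conic-second-difference P H K =
      trans (cong (_+ conic P) (cong₂ _-_ (cong₂ _-_ (conic-⊕⊕ P H K) (conic-⊕ P H)) (conic-⊕ P K)))
            (parabola-second-difference e (L P) (L H) (L K) (M P) (M H) (M K))

    module _ {p} (p-prime : Prime p) where

      parallelogram-on-conic⇒∣L : 2 ℕ.< p → ∀ P H K →
        + p ∣ conic P → + p ∣ conic (P ⊕ H) → + p ∣ conic (P ⊕ K) → + p ∣ conic ((P ⊕ H) ⊕ K) →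
        + p ∣ L H ⊎ + p ∣ L K
      parallelogram-on-conic⇒∣L 2<p P H K p∣f₀ p∣f₁ p∣f₂ p∣f₃ =
        euclidsLemmaℤ p-prime (L H) (L K) (prime∤k∧∣k*i⇒∣i p-prime (L H * L K) p∤2 p∣2LHLK)
        where
        p∤2 : ¬ (+ p ∣ + 2)
        p∤2 = >⇒∤ 2<p ∘ ∣⇒∣ᵤ
        p∣2LHLK : + p ∣ + 2 * (L H * L K)
        p∣2LHLK = subst (+ p ∣_) (conic-second-difference P H K)
          (∣m∣n⇒∣m+n (∣m∣n⇒∣m-n (∣m∣n⇒∣m-n p∣f₃ p∣f₁) p∣f₂) p∣f₀)

      kernel-trivial : ¬ (+ p ∣ a * d - b * c) → ∀ H → + p ∣ L H → + p ∣ M H →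
        + p ∣ proj₁ H × + p ∣ proj₂ H
      kernel-trivial p∤det (h₁ , h₂) p∣LH p∣MH =
        prime∤k∧∣k*i⇒∣i p-prime h₁ p∤det (subst (+ p ∣_) (cramer₁ a b c d h₁ h₂)
          (∣m∣n⇒∣m-n (∣n⇒∣m*n d p∣LH) (∣n⇒∣m*n b p∣MH))) ,
        prime∤k∧∣k*i⇒∣i p-prime h₂ p∤det (subst (+ p ∣_) (cramer₂ a b c d h₁ h₂)
          (∣m∣n⇒∣m-n (∣n⇒∣m*n a p∣MH) (∣n⇒∣m*n c p∣LH)))

      step-on-conic-∣L⇒∣M : ∀ P H → + p ∣ conic P → + p ∣ conic (P ⊕ H) → + p ∣ L H → + p ∣ M H
      step-on-conic-∣L⇒∣M P H p∣f₀ p∣f₁ p∣LH = subst (+ p ∣_) (neg-involutive (M H)) (∣m⇒∣-m p∣-MH)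
        where
        p∣-MH : + p ∣ - M H
        p∣-MH = ∣m+n∣m⇒∣n (subst (+ p ∣_) (conic-first-difference P H) (∣m∣n⇒∣m-n p∣f₁ p∣f₀))
                          (∣m⇒∣m*n (+ 2 * L P + L H) p∣LH)

  module PointsOfA {n p : ℕ} (a b c d e : Fin p) (p-prime : Prime p) where

    open Conic (ι a) (ι b) (ι c) (ι d) (ι e)

    ∈A⇒on-conic : ∀ P → InA n p a b c d e P → + p ∣ conic P
    ∈A⇒on-conic (x , y) (_ , _ , _ , _ , p∣f) = ∣ᵤ⇒∣ p∣f

    step-in-A-∣L⇒trivial : n ℕ.≤ p → Nondegenerate p a b c d → ∀ P H →
      InA n p a b c d e P → InA n p a b c d e (P ⊕ H) → + p ∣ L H → P ≡ P ⊕ H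
    step-in-A-∣L⇒trivial n≤p nondeg (x , y) (h₁ , h₂)
      P∈A@(0≤x , x<n , 0≤y , y<n , _) P+H∈A@(0≤x+h₁ , x+h₁<n , 0≤y+h₂ , y+h₂<n , _) p∣LH =
      cong₂ _,_ (congruent-in-window⇒≡ n≤p 0≤x x<n 0≤x+h₁ x+h₁<n (shift x (proj₁ p∣H)))
                (congruent-in-window⇒≡ n≤p 0≤y y<n 0≤y+h₂ y+h₂<n (shift y (proj₂ p∣H)))
      where
      p∤det : ¬ (+ p ∣ ι a * ι d - ι b * ι c)
      p∤det = nondeg ∘ ∣⇒∣ᵤ ∘ subst (+ p ∣_) (sym (+-identityʳ _))
      p∣MH : + p ∣ M (h₁ , h₂)
      p∣MH = step-on-conic-∣L⇒∣M p-prime (x , y) (h₁ , h₂)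
               (∈A⇒on-conic (x , y) P∈A) (∈A⇒on-conic ((x , y) ⊕ (h₁ , h₂)) P+H∈A) p∣LH
      p∣H : + p ∣ h₁ × + p ∣ h₂
      p∣H = kernel-trivial p-prime p∤det (h₁ , h₂) p∣LH p∣MH
      shift : ∀ u {h} → + p ∣ h → u ≡ u + h [mod p ]
      shift u {h} p∣h = ∣⇒∣ᵤ (subst (+ p ∣_) (sym (u-[u+h]≡-h u h)) (∣m⇒∣-m p∣h))
        where
        u-[u+h]≡-h : ∀ u h → u - (u + h) ≡ - h
        u-[u+h]≡-h = solve-∀

    parallelogram-in-A⇒∣L : 2 ℕ.< p → ∀ P H K →
      InA n p a b c d e P → InA n p a b c d e (P ⊕ H) →
      InA n p a b c d e (P ⊕ K) → InA n p a b c d e ((P ⊕ H) ⊕ K) → + p ∣ L H ⊎ + p ∣ L K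
    parallelogram-in-A⇒∣L 2<p P H K P∈A P+H∈A P+K∈A P+H+K∈A =
      parallelogram-on-conic⇒∣L p-prime 2<p P H K
        (∈A⇒on-conic P P∈A) (∈A⇒on-conic (P ⊕ H) P+H∈A)
        (∈A⇒on-conic (P ⊕ K) P+K∈A) (∈A⇒on-conic ((P ⊕ H) ⊕ K) P+H+K∈A)

open import Data.Nat using (ℕ; _*_; _<_; _≤_; z≤n; s≤s)
open import Data.Nat.Properties using (≤-trans; <-trans; <-≤-trans; <⇒≤; m≤n*m; *-monoʳ-≤)
open import Data.Nat.Primality using (Prime)
open import Data.Fin using (Fin)
open import Data.Sum using ([_,_]′)
open import Relation.Nullary using (¬_)

lemma1p6 : (n p : ℕ) → 1 ≤ n → Prime p → 4 * n < p → p < 8 * n →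
    (a b c d e : Fin p) → Nondegenerate p a b c d →
    ¬ HasParallelogram (InA n p a b c d e)
lemma1p6 n p 1≤n p-prime 4n<p _ a b c d e nondeg
  (P , H , K , P∈A , P+H∈A , P+K∈A , P+H+K∈A , P≢P+H , P≢P+K , _) =
  [ P≢P+H ∘ step-in-A-∣L⇒trivial n≤p nondeg P H P∈A P+H∈A
  , P≢P+K ∘ step-in-A-∣L⇒trivial n≤p nondeg P K P∈A P+K∈A
  ]′ (parallelogram-in-A⇒∣L 2<p P H K P∈A P+H∈A P+K∈A P+H+K∈A)
  where
  open PointsOfA a b c d e p-prime
  n≤p : n ≤ p
  n≤p = ≤-trans (m≤n*m n 4) (<⇒≤ 4n<p)
  2<p : 2 < p
  2<p = <-trans (<-≤-trans (s≤s (s≤s (s≤s z≤n))) (*-monoʳ-≤ 4 1≤n)) 4n<p
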